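{- Let $m\ge 1$ and $k\ge r\ge 1$ be integers and put $N=2m(k+r-1)$. Consider the two symplectic partitions of $2N=4m(k+r-1)$ $$\mathcal{P}_1=\big((2k-1)^{2m}(2r-1)^{2m}\big),\qquad \mathcal{P}_2=\big((2k)^{2m}(2r-2)^{2m}\big),$$ where $a^{e}$ denotes the part $a$ repeated $e$ times, and parts equal to $0$ are omitted (so for $r=1$, $\mathcal{P}_2=((2k)^{2m})$). Then $$\dim(Sp_{2m})+\tfrac{1}{2}\dim\mathcal{P}_1=\tfrac{1}{2}\dim\mathcal{P}_2,$$ where $\dim(Sp_{2m})=2m^2+m$ and $\dim\mathcal{P}_i$ denotes the dimension of the unipotent (nilpotent) orbit of $Sp_{2N}$ attached to $\mathcal{P}_i$.
   Context: Unipotent orbits of the symplectic group $Sp_{2N}$ (over an algebraically closed field) are indexed by symplectic partitions of $2N$, i.e. partitions in which every odd part occurs with even multiplicity. For such a partition written in non-increasing order as $(n_1 n_2\ldots n_t)$, $n_1\ge n_2\ge\dots\ge n_t>0$, the dimension of the corresponding orbit is $$\dim\mathcal{O}=2N^2+N-\frac{1}{2}\sum_{i=1}^{t}(2i-1)n_i-\frac{1}{2}a,$$ where $a$ is the number of odd integers among $n_1,\dots,n_t$ (counted with multiplicity). -}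

module Defs where

open import Data.Nat using (ℕ; zero; suc; _+_; _*_; _∸_; _%_; _/_)
open import Data.Nat.Properties using (_≟_)
open import Data.List using (List; []; _∷_; _++_; replicate; filter; length)
open import Data.Integer using (ℤ; +_; _-_)
open import Relation.Nullary.Decidable using (¬?)

-- Partitions are lists of positive parts in non-increasing order (n₁ ≥ n₂ ≥ … ≥ nₜ).

pow : ℕ → ℕ → List ℕ
pow zero    e = []
pow (suc a) e = replicate e (suc a)

weightedFrom : ℕ → List ℕ → ℕ
weightedFrom j []       = 0
weightedFrom j (n ∷ ns) = (2 * j ∸ 1) * n + weightedFrom (suc j) ns

weightedSum : List ℕ → ℕ
weightedSum = weightedFrom 1

numOdd : List ℕ → ℕ
numOdd ns = length (filter (λ n → n % 2 ≟ 1) ns)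

-- dim of the unipotent orbit of Sp_{2N} attached to the symplectic partition λ:
-- 2N² + N − ½ Σ (2i−1) nᵢ − ½ a   (the quantity Σ(2i−1)nᵢ + a is even for
-- symplectic partitions, so the division by 2 is exact).
orbitDim : ℕ → List ℕ → ℤ
orbitDim N ps = + (2 * N * N + N) - + ((weightedSum ps + numOdd ps) / 2)

dimSp : ℕ → ℕ
dimSp m = 2 * m * m + m

P₁ : ℕ → ℕ → ℕ → List ℕ
P₁ m k r = pow (2 * k ∸ 1) (2 * m) ++ pow (2 * r ∸ 1) (2 * m)

P₂ : ℕ → ℕ → ℕ → List ℕ
P₂ m k r = pow (2 * k) (2 * m) ++ pow (2 * r ∸ 2) (2 * m)

module Submission where

-- Write M = 2m and substitute k = k′+1, r = r′+1 (the case k = 0 is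
-- excluded by 1 ≤ r ≤ k).  Both partitions consist of two blocks of M equal parts,
-- P₁ = (2k′+1)^M (2r′+1)^M and P₂ = (2k′+2)^M (2r′)^M.  Since the odd numbers
-- 2i−1 for i = j+1, …, j+e add up to e² + 2je, a two-block partition a^M b^M has
-- weighted sum Σ(2i−1)nᵢ = a·M² + b·3M².  P₁ has M + M odd parts and P₂ none, so
--   Σ(2i−1)nᵢ + a  =  2·(H + 2·dim Sp_{2m})  for P₁,   2·H  for P₂,
-- with H = (2k′+2)·2m² + 2r′·6m².  Hence dim P₁ = T − H − 2·dim Sp_{2m} and
-- dim P₂ = T − H, where T = 2N² + N, which is the claim.

open import Defs
open import Data.Nat using (ℕ; zero; suc; _≤_; _+_; _*_; _∸_; _%_; _/_)
open import Data.Nat.Properties using (_≟_; +-suc; +-comm; +-assoc; *-comm)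
open import Data.Nat.DivMod using ([m+kn]%n≡m%n; m*n%n≡0; m*n/n≡m)
open import Data.Nat.Tactic.RingSolver using (solve-∀)
open import Data.Integer using (ℤ; +_) renaming (_+_ to _+ℤ_; _*_ to _*ℤ_; _-_ to _-ℤ_)
open import Data.Integer.Properties using (pos-+; pos-*)
import Data.Integer.Tactic.RingSolver as ℤ-Solver
open import Data.Empty using (⊥)
open import Relation.Nullary using (Dec)
open import Data.List using (List; []; _∷_; _++_; replicate; filter; length)
open import Data.List.Properties using (filter-++; filter-accept; filter-reject; length-++; length-replicate)
open import Relation.Binary.PropositionalEquality using (_≡_; refl; sym; trans; cong; cong₂; module ≡-Reasoning)

odd-part : ∀ n → 2 * suc n ∸ 1 ≡ suc (2 * n)
odd-part n rewrite +-suc n (n + 0) = refl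

even-part : ∀ n → 2 * suc n ∸ 2 ≡ 2 * n
even-part n rewrite +-suc n (n + 0) = refl

weightedFrom-++ : ∀ j (xs ys : List ℕ) →
  weightedFrom j (xs ++ ys) ≡ weightedFrom j xs + weightedFrom (j + length xs) ys
weightedFrom-++ j []       ys = cong (λ i → weightedFrom i ys) (sym (+-comm j 0))
weightedFrom-++ j (x ∷ xs) ys
  rewrite weightedFrom-++ (suc j) xs ys | +-suc j (length xs) =
  sym (+-assoc ((2 * j ∸ 1) * x) (weightedFrom (suc j) xs) _)

-- A block of e equal parts a occupying positions j+1, …, j+e contributes
-- a·Σ_{i=j+1}^{j+e}(2i−1) = a·(e² + 2je).
weightedFrom-replicate : ∀ a j e →
  weightedFrom (suc j) (replicate e a) ≡ a * (e * e + 2 * j * e)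
weightedFrom-replicate a j zero    = empty a j
  where
  empty : ∀ a j → 0 ≡ a * (0 * 0 + 2 * j * 0)
  empty = solve-∀
weightedFrom-replicate a j (suc e) = begin
  (2 * suc j ∸ 1) * a + weightedFrom (suc (suc j)) (replicate e a)
    ≡⟨ cong₂ _+_ (cong (_* a) (odd-part j)) (weightedFrom-replicate a (suc j) e) ⟩
  suc (2 * j) * a + a * (e * e + 2 * (1 + j) * e)
    ≡⟨ step a j e ⟩
  a * ((1 + e) * (1 + e) + 2 * j * (1 + e)) ∎
  where
  open ≡-Reasoning
  step : ∀ a j e → suc (2 * j) * a + a * (e * e + 2 * (1 + j) * e)
                   ≡ a * ((1 + e) * (1 + e) + 2 * j * (1 + e))
  step = solve-∀

weightedFrom-pow : ∀ a j e → weightedFrom (suc j) (pow a e) ≡ a * (e * e + 2 * j * e)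
weightedFrom-pow zero    j e = refl
weightedFrom-pow (suc a) j e = weightedFrom-replicate (suc a) j e

-- A partition a^M b^M made of two blocks has weighted sum a·M² + b·3M²
-- (the first block is written with replicate, so its length is M even for a = 0).
weightedSum-twoBlocks : ∀ a b M →
  weightedSum (replicate M a ++ pow b M) ≡ a * (M * M) + b * (3 * (M * M))
weightedSum-twoBlocks a b M = begin
  weightedSum (replicate M a ++ pow b M)
    ≡⟨ weightedFrom-++ 1 (replicate M a) (pow b M) ⟩
  weightedFrom 1 (replicate M a) + weightedFrom (suc (length (replicate M a))) (pow b M)
    ≡⟨ cong₂ _+_ (weightedFrom-replicate a 0 M)
                 (cong (λ l → weightedFrom (suc l) (pow b M)) (length-replicate M)) ⟩
  a * (M * M + 2 * 0 * M) + weightedFrom (suc M) (pow b M)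
    ≡⟨ cong (_+_ (a * (M * M + 2 * 0 * M))) (weightedFrom-pow b M M) ⟩
  a * (M * M + 2 * 0 * M) + b * (M * M + 2 * M * M)
    ≡⟨ normalise a b M ⟩
  a * (M * M) + b * (3 * (M * M)) ∎
  where
  open ≡-Reasoning
  normalise : ∀ a b M → a * (M * M + 2 * 0 * M) + b * (M * M + 2 * M * M)
                        ≡ a * (M * M) + b * (3 * (M * M))
  normalise = solve-∀

isOdd? : (n : ℕ) → Dec (n % 2 ≡ 1)
isOdd? n = n % 2 ≟ 1

numOdd-++ : ∀ (xs ys : List ℕ) → numOdd (xs ++ ys) ≡ numOdd xs + numOdd ys
numOdd-++ xs ys = trans (cong length (filter-++ isOdd? xs ys)) (length-++ (filter isOdd? xs))

numOdd-replicate-odd : ∀ n e → numOdd (replicate e (suc (2 * n))) ≡ e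
numOdd-replicate-odd n zero    = refl
numOdd-replicate-odd n (suc e) =
  trans (cong length (filter-accept isOdd? {suc (2 * n)} {replicate e (suc (2 * n))} odd))
        (cong suc (numOdd-replicate-odd n e))
  where
  odd : suc (2 * n) % 2 ≡ 1
  odd rewrite *-comm 2 n = [m+kn]%n≡m%n 1 n 2

numOdd-replicate-even : ∀ n e → numOdd (replicate e (2 * n)) ≡ 0
numOdd-replicate-even n zero    = refl
numOdd-replicate-even n (suc e) =
  trans (cong length (filter-reject isOdd? {2 * n} {replicate e (2 * n)} not-odd))
        (numOdd-replicate-even n e)
  where
  even : (2 * n) % 2 ≡ 0
  even rewrite *-comm 2 n = m*n%n≡0 n 2
  not-odd : (2 * n) % 2 ≡ 1 → ⊥
  not-odd odd with trans (sym even) odd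
  ... | ()

numOdd-pow-even : ∀ n e → numOdd (pow (2 * n) e) ≡ 0
numOdd-pow-even zero    e = refl
numOdd-pow-even (suc n) e = numOdd-replicate-even (suc n) e

orbitDim-half : ∀ N ps h → weightedSum ps + numOdd ps ≡ 2 * h →
  orbitDim N ps ≡ + (2 * N * N + N) -ℤ + h
orbitDim-half N ps h total = cong (λ x → + (2 * N * N + N) -ℤ + x) half
  where
  half : (weightedSum ps + numOdd ps) / 2 ≡ h
  half = trans (cong (_/ 2) (trans total (*-comm 2 h))) (m*n/n≡m h 2)

halfNumerator₂ : ℕ → ℕ → ℕ → ℕ
halfNumerator₂ m k′ r′ = (2 * k′ + 2) * (2 * (m * m)) + 2 * r′ * (6 * (m * m))

P₁-numerator : ∀ m k′ r′ →
  weightedSum (P₁ m (suc k′) (suc r′)) + numOdd (P₁ m (suc k′) (suc r′))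
    ≡ 2 * (halfNumerator₂ m k′ r′ + 2 * dimSp m)
P₁-numerator m k′ r′ rewrite odd-part k′ | odd-part r′ = begin
  weightedSum (blocks ++ pow (suc (2 * r′)) M) + numOdd (blocks ++ pow (suc (2 * r′)) M)
    ≡⟨ cong₂ _+_ (weightedSum-twoBlocks (suc (2 * k′)) (suc (2 * r′)) M)
                 (trans (numOdd-++ blocks (pow (suc (2 * r′)) M))
                        (cong₂ _+_ (numOdd-replicate-odd k′ M) (numOdd-replicate-odd r′ M))) ⟩
  suc (2 * k′) * (M * M) + suc (2 * r′) * (3 * (M * M)) + (M + M)
    ≡⟨ normalise m k′ r′ ⟩
  2 * (halfNumerator₂ m k′ r′ + 2 * dimSp m) ∎
  where
  open ≡-Reasoning
  M = 2 * m
  blocks = replicate M (suc (2 * k′))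
  normalise : ∀ m k′ r′ →
    suc (2 * k′) * (2 * m * (2 * m)) + suc (2 * r′) * (3 * (2 * m * (2 * m))) + (2 * m + 2 * m)
      ≡ 2 * ((2 * k′ + 2) * (2 * (m * m)) + 2 * r′ * (6 * (m * m)) + 2 * (2 * m * m + m))
  normalise = solve-∀

P₂-numerator : ∀ m k′ r′ →
  weightedSum (P₂ m (suc k′) (suc r′)) + numOdd (P₂ m (suc k′) (suc r′))
    ≡ 2 * halfNumerator₂ m k′ r′
P₂-numerator m k′ r′ rewrite even-part r′ = begin
  weightedSum (blocks ++ pow (2 * r′) M) + numOdd (blocks ++ pow (2 * r′) M)
    ≡⟨ cong₂ _+_ (weightedSum-twoBlocks (2 * suc k′) (2 * r′) M)
                 (trans (numOdd-++ blocks (pow (2 * r′) M))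
                        (cong₂ _+_ (numOdd-replicate-even (suc k′) M) (numOdd-pow-even r′ M))) ⟩
  2 * suc k′ * (M * M) + 2 * r′ * (3 * (M * M)) + 0
    ≡⟨ normalise m k′ r′ ⟩
  2 * halfNumerator₂ m k′ r′ ∎
  where
  open ≡-Reasoning
  M = 2 * m
  blocks = replicate M (2 * suc k′)
  normalise : ∀ m k′ r′ →
    2 * suc k′ * (2 * m * (2 * m)) + 2 * r′ * (3 * (2 * m * (2 * m))) + 0
      ≡ 2 * ((2 * k′ + 2) * (2 * (m * m)) + 2 * r′ * (6 * (m * m)))
  normalise = solve-∀

lemma1 : (m k r : ℕ) → 1 ≤ m → 1 ≤ r → r ≤ k →
    (+ 2) *ℤ (+ dimSp m) +ℤ orbitDim (2 * m * (k + r ∸ 1)) (P₁ m k r)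
      ≡ orbitDim (2 * m * (k + r ∸ 1)) (P₂ m k r)
lemma1 m zero    (suc r′) _ _ ()
lemma1 m (suc k′) (suc r′) _ _ _ = begin
  + 2 *ℤ + D +ℤ orbitDim N (P₁ m (suc k′) (suc r′))
    ≡⟨ cong (_+ℤ_ (+ 2 *ℤ + D))
            (orbitDim-half N (P₁ m (suc k′) (suc r′)) (H + 2 * D) (P₁-numerator m k′ r′)) ⟩
  + 2 *ℤ + D +ℤ (+ T -ℤ + (H + 2 * D))
    ≡⟨ cong (λ x → + 2 *ℤ + D +ℤ (+ T -ℤ x))
            (trans (pos-+ H (2 * D)) (cong (+ H +ℤ_) (pos-* 2 D))) ⟩
  + 2 *ℤ + D +ℤ (+ T -ℤ (+ H +ℤ + 2 *ℤ + D))
    ≡⟨ cancel (+ T) (+ H) (+ D) ⟩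
  + T -ℤ + H
    ≡⟨ sym (orbitDim-half N (P₂ m (suc k′) (suc r′)) H (P₂-numerator m k′ r′)) ⟩
  orbitDim N (P₂ m (suc k′) (suc r′)) ∎
  where
  open ≡-Reasoning
  N = 2 * m * (suc k′ + suc r′ ∸ 1)
  T = 2 * N * N + N
  H = halfNumerator₂ m k′ r′
  D = dimSp m
  cancel : ∀ (T H D : ℤ) → + 2 *ℤ D +ℤ (T -ℤ (H +ℤ + 2 *ℤ D)) ≡ T -ℤ H
  cancel = ℤ-Solver.solve-∀
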